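{- Let $n=2m$ with $m\ge 1$, and let $\mathcal{B}_m$ be a basis of $\mathcal{L}_m$ consisting of $m\times m$ permutation matrices. For $1\le i,j\le m$ let $P_{i,j}$ be the $m\times m$ $(0,1)$-matrix with exactly one $1$, located in position $(i,j)$, and let $Q_{i,j}$ be any $m\times m$ $(0,1)$-matrix having all $0$'s in row $i$ and in column $m+1-j$ such that deleting row $i$ and column $m+1-j$ from $Q_{i,j}$ results in a permutation matrix. Then the $(m-1)^2+1$ matrices \[\begin{bmatrix} P & O_m\\ O_m & P^{\pi}\end{bmatrix}\quad (P\in\mathcal{B}_m)\] together with the $m^2$ matrices \[\begin{bmatrix} Q_{i,j} & P_{i,j}\\ P_{i,j}^{\pi} & Q_{i,j}^{\pi}\end{bmatrix}\quad (1\le i,j\le m)\] are centrosymmetric permutation matrices and form a basis of the real vector space $\mathcal{C}_n$.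
   Context: For a $k\times k$ matrix $X=[x_{ij}]$, $X^{\pi}$ is the matrix whose $(i,j)$ entry is $x_{k+1-i,k+1-j}$ (rotation by 180 degrees); $X$ is centrosymmetric if $X^{\pi}=X$. $O_m$ is the $m\times m$ zero matrix. $\mathcal{L}_m$ denotes the real vector space spanned by all $m\times m$ permutation matrices (it has dimension $(m-1)^2+1$), and $\mathcal{C}_n$ denotes the real vector space spanned by all $n\times n$ centrosymmetric permutation matrices.
   Formalization: The vector spaces $\mathcal{L}_m$ and $\mathcal{C}_n$, together with linear independence and spanning, are taken over ℚ instead of the reals. -}

module Defs where

open import Data.Nat using (ℕ; zero; suc; _+_; _*_)
open import Data.Fin using (Fin; zero; suc; opposite; punchIn; splitAt; remQuot; _≟_)
open import Data.Fin.Permutation using (Permutation′; _⟨$⟩ʳ_)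
open import Data.Rational using (ℚ; 0ℚ; 1ℚ) renaming (_+_ to _+q_; _*_ to _*q_)
open import Data.Product using (Σ; _×_; _,_; proj₁; proj₂)
open import Data.Sum using (_⊎_; inj₁; inj₂)
open import Data.Bool using (if_then_else_)
open import Relation.Nullary using (does)
open import Relation.Binary.PropositionalEquality using (_≡_)

-- k × k real (here: rational) matrices, indices 0-based
Mat : ℕ → Set
Mat k = Fin k → Fin k → ℚ

_ᵖ : ∀ {k} → Mat k → Mat k
(X ᵖ) i j = X (opposite i) (opposite j)

Centrosymmetric : ∀ {k} → Mat k → Set
Centrosymmetric X = ∀ i j → (X ᵖ) i j ≡ X i j

permMat : ∀ {k} → Permutation′ k → Mat k
permMat σ i j = if does ((σ ⟨$⟩ʳ i) ≟ j) then 1ℚ else 0ℚ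

IsPermMatrix : ∀ {k} → Mat k → Set
IsPermMatrix {k} M = Σ (Permutation′ k) λ σ → ∀ i j → M i j ≡ permMat σ i j

IsCentroPermMatrix : ∀ {k} → Mat k → Set
IsCentroPermMatrix M = IsPermMatrix M × Centrosymmetric M

O : ∀ {k} → Mat k
O _ _ = 0ℚ

Σ[_] : ∀ {r} → (Fin r → ℚ) → ℚ
Σ[_] {zero} f = 0ℚ
Σ[_] {suc r} f = f zero +q Σ[ (λ t → f (suc t)) ]

lincomb : ∀ {k r} → (Fin r → ℚ) → (Fin r → Mat k) → Mat k
lincomb c F i j = Σ[ (λ t → c t *q F t i j) ]

InSpanFam : ∀ {k r} → (Fin r → Mat k) → Mat k → Set
InSpanFam F M = Σ (Fin _ → ℚ) λ c → ∀ i j → M i j ≡ lincomb c F i j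

LinIndep : ∀ {k r} → (Fin r → Mat k) → Set
LinIndep F = ∀ c → (∀ i j → lincomb c F i j ≡ 0ℚ) → ∀ t → c t ≡ 0ℚ

Span : ∀ {k} → (Mat k → Set) → Mat k → Set
Span {k} S M = Σ ℕ λ r → Σ (Fin r → Mat k) λ F → (∀ t → S (F t)) × InSpanFam F M

𝓛 : (k : ℕ) → Mat k → Set
𝓛 k = Span (IsPermMatrix {k})

𝓒 : (k : ℕ) → Mat k → Set
𝓒 k = Span (IsCentroPermMatrix {k})

IsBasisOf : ∀ {k r} → (Mat k → Set) → (Fin r → Mat k) → Set
IsBasisOf V F = (∀ t → V (F t)) × LinIndep F × (∀ M → V M → InSpanFam F M)

block : ∀ {m} → Mat m → Mat m → Mat m → Mat m → Mat (m + m)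
block {m} A B C D i j with splitAt m i | splitAt m j
... | inj₁ a | inj₁ b = A a b
... | inj₁ a | inj₂ b = B a b
... | inj₂ a | inj₁ b = C a b
... | inj₂ a | inj₂ b = D a b

E : ∀ {m} → Fin m → Fin m → Mat m
E i j a b = if does (a ≟ i) then (if does (b ≟ j) then 1ℚ else 0ℚ) else 0ℚ

ZeroOne : ∀ {k} → Mat k → Set
ZeroOne M = ∀ a b → (M a b ≡ 0ℚ) ⊎ (M a b ≡ 1ℚ)

QCond : ∀ {m'} → Fin (suc m') → Fin (suc m') → Mat (suc m') → Set
QCond i c Q =
  ZeroOne Q × (∀ b → Q i b ≡ 0ℚ) × (∀ a → Q a c ≡ 0ℚ)
  × IsPermMatrix (λ a b → Q (punchIn i a) (punchIn c b))

theFamily : ∀ {m r} → (Fin r → Mat m) → (Fin m → Fin m → Mat m) → Fin (r + m * m) → Mat (m + m)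
theFamily {m} {r} B Q t with splitAt r t
... | inj₁ s = block (B s) O O (B s ᵖ)
... | inj₂ u with remQuot {m} m u
... | (i , j) = block (Q i j) (E i j) (E i j ᵖ) (Q i j ᵖ)

-- A centrosymmetric permutation matrix of order 2m is [A C; Cᵖ Aᵖ], and folding its top half
-- gives the permutation matrix A + C J of order m (J the reversal matrix); conversely a top half
-- with a single 1 per row that folds to a permutation extends to a centrosymmetric permutation
-- matrix.  This shows that every listed matrix is one.  In a linear combination of the family,
-- the top-right block is the coefficient matrix C of the second kind of matrices and the top-left
-- block is Σ e_s B_s + Σ C i j Q i j, so independence is inherited from B.  For spanning, given
-- P = [A C; Cᵖ Aᵖ], the matrix A - Σ C i j Q i j equals (A + C J) - Σ C i j (Q i j + P_{i,m+1-j}),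
-- a combination of permutation matrices, hence some Σ e_s B_s; then P is the combination of the
-- family with coefficients e and C.

module Submission where

open import Defs
open import Data.Bool using (if_then_else_)
open import Data.Empty using (⊥-elim)
open import Data.Nat using (ℕ; zero; suc; _+_; _*_; _∸_)
open import Data.Fin using (Fin; zero; suc; toℕ; _↑ˡ_; _↑ʳ_; _≟_; combine; remQuot; opposite; punchIn; punchOut; splitAt)
open import Data.Fin.Properties using (any?; injective⇒≤; opposite-involutive; opposite-prop; punchIn-injective; punchIn-punchOut; punchInᵢ≢i; punchOut-injective; suc-injective; remQuot-combine; combine-remQuot; splitAt-↑ˡ; splitAt-↑ʳ; splitAt⁻¹-↑ˡ; splitAt⁻¹-↑ʳ; ↑ˡ-injective; ↑ʳ-injective; toℕ-injective; toℕ-↑ˡ; toℕ-↑ʳ; toℕ<n)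
open import Data.Fin.Permutation using (Permutation′; _⟨$⟩ʳ_; _⟨$⟩ˡ_; inverseˡ; inverseʳ; permutation; insert; insert-punchIn)
import Data.Fin.Permutation as Perm
import Data.Nat.Properties as ℕ
open import Data.Product using (∃; _×_; _,_; proj₁; proj₂)
open import Data.Rational using (ℚ; 0ℚ; 1ℚ) renaming (_+_ to _+q_; _*_ to _*q_; -_ to -q_)
import Data.Rational.Properties as ℚ
open import Data.Rational.Solver using (module +-*-Solver)
open import Data.Sum using (_⊎_; inj₁; inj₂; [_,_]′)
open import Function using (_∘_; id)
open import Function.Bundles using (Injection)
open import Function.Definitions using (Injective)
open import Function.Properties.Inverse using (↔⇒↣)
open import Relation.Binary.PropositionalEquality
open import Relation.Nullary using (Dec; yes; no; does)
open +-*-Solver using (solve; _:+_; _:*_; :-_; _:=_; con)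

Σ-cong : ∀ {r} {f g : Fin r → ℚ} → (∀ t → f t ≡ g t) → Σ[ f ] ≡ Σ[ g ]
Σ-cong {zero}  f≗g = refl
Σ-cong {suc r} f≗g = cong₂ _+q_ (f≗g zero) (Σ-cong (f≗g ∘ suc))

Σ-zero : ∀ {r} {f : Fin r → ℚ} → (∀ t → f t ≡ 0ℚ) → Σ[ f ] ≡ 0ℚ
Σ-zero {zero}  f≗0 = refl
Σ-zero {suc r} f≗0 = cong₂ _+q_ (f≗0 zero) (Σ-zero (f≗0 ∘ suc))

Σ-+ : ∀ {r} (f g : Fin r → ℚ) → Σ[ (λ t → f t +q g t) ] ≡ Σ[ f ] +q Σ[ g ]
Σ-+ {zero}  f g = refl
Σ-+ {suc r} f g = begin
  (f zero +q g zero) +q Σ[ (λ t → f (suc t) +q g (suc t)) ]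
    ≡⟨ cong ((f zero +q g zero) +q_) (Σ-+ (f ∘ suc) (g ∘ suc)) ⟩
  (f zero +q g zero) +q (Σ[ f ∘ suc ] +q Σ[ g ∘ suc ])
    ≡⟨ solve 4 (λ a b c d → (a :+ b) :+ (c :+ d) := (a :+ c) :+ (b :+ d)) refl (f zero) (g zero) _ _ ⟩
  (f zero +q Σ[ f ∘ suc ]) +q (g zero +q Σ[ g ∘ suc ]) ∎
  where open ≡-Reasoning

Σ-*ˡ : ∀ {r} (x : ℚ) (f : Fin r → ℚ) → Σ[ (λ t → x *q f t) ] ≡ x *q Σ[ f ]
Σ-*ˡ {zero}  x f = sym (ℚ.*-zeroʳ x)
Σ-*ˡ {suc r} x f =
  trans (cong (x *q f zero +q_) (Σ-*ˡ x (f ∘ suc))) (sym (ℚ.*-distribˡ-+ x (f zero) _))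

Σ-*ʳ : ∀ {r} (f : Fin r → ℚ) (x : ℚ) → Σ[ (λ t → f t *q x) ] ≡ Σ[ f ] *q x
Σ-*ʳ f x = trans (Σ-cong (λ t → ℚ.*-comm (f t) x)) (trans (Σ-*ˡ x f) (ℚ.*-comm x _))

Σ-neg : ∀ {r} (f : Fin r → ℚ) → Σ[ (λ t → -q f t) ] ≡ -q Σ[ f ]
Σ-neg {zero}  f = refl
Σ-neg {suc r} f = trans (cong (-q f zero +q_) (Σ-neg (f ∘ suc))) (sym (ℚ.neg-distrib-+ (f zero) _))

Σ-swap : ∀ {r s} (f : Fin r → Fin s → ℚ) →
         Σ[ (λ a → Σ[ (λ b → f a b) ]) ] ≡ Σ[ (λ b → Σ[ (λ a → f a b) ]) ]
Σ-swap {zero} {s} f = sym (Σ-zero {s} (λ _ → refl))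
Σ-swap {suc r} f = trans (cong (Σ[ f zero ] +q_) (Σ-swap (f ∘ suc)))
  (sym (Σ-+ (f zero) (λ b → Σ[ (λ a → f (suc a) b) ])))

Σ-single : ∀ {r} (f : Fin r → ℚ) (a : Fin r) → (∀ t → t ≢ a → f t ≡ 0ℚ) → Σ[ f ] ≡ f a
Σ-single f zero    f≗0 = trans (cong (f zero +q_) (Σ-zero (λ t → f≗0 (suc t) λ ()))) (ℚ.+-identityʳ _)
Σ-single f (suc a) f≗0 = trans (cong₂ _+q_ (f≗0 zero λ ()) (Σ-single (f ∘ suc) a f∘suc≗0)) (ℚ.+-identityˡ _)
  where
  f∘suc≗0 : ∀ t → t ≢ a → f (suc t) ≡ 0ℚ
  f∘suc≗0 t t≢a = f≗0 (suc t) (t≢a ∘ suc-injective)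

Σ-split : ∀ r {k} (f : Fin (r + k) → ℚ) → Σ[ f ] ≡ Σ[ (λ s → f (s ↑ˡ k)) ] +q Σ[ (λ u → f (r ↑ʳ u)) ]
Σ-split zero    f = sym (ℚ.+-identityˡ _)
Σ-split (suc r) f = trans (cong (f zero +q_) (Σ-split r (f ∘ suc))) (sym (ℚ.+-assoc (f zero) _ _))

Σ-combine : ∀ m {n} (f : Fin (m * n) → ℚ) →
            Σ[ f ] ≡ Σ[ (λ (i : Fin m) → Σ[ (λ (j : Fin n) → f (combine i j)) ]) ]
Σ-combine zero    f = refl
Σ-combine (suc m) {n} f =
  trans (Σ-split n f) (cong (Σ[ (λ j → f (j ↑ˡ (m * n))) ] +q_) (Σ-combine m {n} (λ u → f (n ↑ʳ u))))

-- The same test as in permMat, so permMat σ i j is definitionally δ (σ ⟨$⟩ʳ i) j.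
δ : ∀ {k} → Fin k → Fin k → ℚ
δ x y = if does (x ≟ y) then 1ℚ else 0ℚ

δ-refl : ∀ {k} (x : Fin k) → δ x x ≡ 1ℚ
δ-refl x with x ≟ x
... | yes _   = refl
... | no x≢x = ⊥-elim (x≢x refl)

δ-≢ : ∀ {k} {x y : Fin k} → x ≢ y → δ x y ≡ 0ℚ
δ-≢ {x = x} {y} x≢y with x ≟ y
... | yes x≡y = ⊥-elim (x≢y x≡y)
... | no _    = refl

δ≡1⇒≡ : ∀ {k} {x y : Fin k} → δ x y ≡ 1ℚ → x ≡ y
δ≡1⇒≡ {x = x} {y} δ≡1 with x ≟ y
... | yes x≡y = x≡y
... | no _    = ⊥-elim (ℚ.1≢0 (sym δ≡1))

δ-sym : ∀ {k} (x y : Fin k) → δ x y ≡ δ y x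
δ-sym x y with x ≟ y
... | yes refl = sym (δ-refl x)
... | no x≢y   = sym (δ-≢ (x≢y ∘ sym))

δ-injective : ∀ {k l} {g : Fin k → Fin l} → Injective _≡_ _≡_ g → ∀ x y → δ (g x) (g y) ≡ δ x y
δ-injective {g = g} g-inj x y with x ≟ y
... | yes refl = δ-refl (g x)
... | no x≢y   = δ-≢ (x≢y ∘ g-inj)

E-diag : ∀ {m} (i j b : Fin m) → E i j i b ≡ δ b j
E-diag i j b with i ≟ i
... | yes _   = refl
... | no i≢i = ⊥-elim (i≢i refl)

E-≢ : ∀ {m} (i j : Fin m) {a} b → a ≢ i → E i j a b ≡ 0ℚ
E-≢ i j {a} b a≢i with a ≟ i
... | yes a≡i = ⊥-elim (a≢i a≡i)
... | no _    = refl

-- The two halves of Fin (m + m)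

data SplitView (m n : ℕ) : Fin (m + n) → Set where
  left  : (a : Fin m) → SplitView m n (a ↑ˡ n)
  right : (b : Fin n) → SplitView m n (m ↑ʳ b)

splitView : ∀ m {n} (x : Fin (m + n)) → SplitView m n x
splitView m {n} x with splitAt m x in eq
... | inj₁ a = subst (SplitView m n) (splitAt⁻¹-↑ˡ eq) (left a)
... | inj₂ b = subst (SplitView m n) (splitAt⁻¹-↑ʳ eq) (right b)

↑ˡ≢↑ʳ : ∀ {m n} (a : Fin m) (b : Fin n) → a ↑ˡ n ≢ m ↑ʳ b
↑ˡ≢↑ʳ {m} {n} a b eq
  with () ← trans (sym (splitAt-↑ˡ m a n)) (trans (cong (splitAt m) eq) (splitAt-↑ʳ m n b))

opposite-injective : ∀ {k} → Injective _≡_ _≡_ (opposite {k})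
opposite-injective {x = x} {y} eq =
  trans (sym (opposite-involutive x)) (trans (cong opposite eq) (opposite-involutive y))

opposite-↑ˡ : ∀ {m} (a : Fin m) → opposite (a ↑ˡ m) ≡ m ↑ʳ opposite a
opposite-↑ˡ {m} a = toℕ-injective (begin
  toℕ (opposite (a ↑ˡ m))      ≡⟨ opposite-prop (a ↑ˡ m) ⟩
  (m + m) ∸ suc (toℕ (a ↑ˡ m)) ≡⟨ cong (λ z → (m + m) ∸ suc z) (toℕ-↑ˡ a m) ⟩
  (m + m) ∸ suc (toℕ a)        ≡⟨ ℕ.+-∸-assoc m (toℕ<n a) ⟩
  m + (m ∸ suc (toℕ a))        ≡⟨ cong (m +_) (opposite-prop a) ⟨
  m + toℕ (opposite a)         ≡⟨ toℕ-↑ʳ m (opposite a) ⟨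
  toℕ (m ↑ʳ opposite a)        ∎)
  where open ≡-Reasoning

opposite-↑ʳ : ∀ {m} (a : Fin m) → opposite (m ↑ʳ a) ≡ opposite a ↑ˡ m
opposite-↑ʳ {m} a = opposite-injective (begin
  opposite (opposite (m ↑ʳ a)) ≡⟨ opposite-involutive _ ⟩
  m ↑ʳ a                       ≡⟨ cong (m ↑ʳ_) (opposite-involutive a) ⟨
  m ↑ʳ opposite (opposite a)   ≡⟨ opposite-↑ˡ (opposite a) ⟨
  opposite (opposite a ↑ˡ m)   ∎)
  where open ≡-Reasoning

fold : ∀ {m} → Fin (m + m) → Fin m
fold {m} x = [ id , opposite ]′ (splitAt m x)

fold-↑ˡ : ∀ {m} (a : Fin m) → fold (a ↑ˡ m) ≡ a
fold-↑ˡ {m} a rewrite splitAt-↑ˡ m a m = refl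

fold-↑ʳ : ∀ {m} (b : Fin m) → fold (m ↑ʳ b) ≡ opposite b
fold-↑ʳ {m} b rewrite splitAt-↑ʳ m m b = refl

fold-opposite : ∀ {m} (x : Fin (m + m)) → fold (opposite x) ≡ fold x
fold-opposite {m} x with splitView m x
... | left a  = begin
  fold (opposite (a ↑ˡ m))  ≡⟨ cong fold (opposite-↑ˡ a) ⟩
  fold (m ↑ʳ opposite a)    ≡⟨ fold-↑ʳ (opposite a) ⟩
  opposite (opposite a)     ≡⟨ opposite-involutive a ⟩
  a                         ≡⟨ fold-↑ˡ a ⟨
  fold (a ↑ˡ m)             ∎
  where open ≡-Reasoning
... | right b = begin
  fold (opposite (m ↑ʳ b))  ≡⟨ cong fold (opposite-↑ʳ b) ⟩
  fold (opposite b ↑ˡ m)    ≡⟨ fold-↑ˡ (opposite b) ⟩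
  opposite b                ≡⟨ fold-↑ʳ b ⟨
  fold (m ↑ʳ b)             ∎
  where open ≡-Reasoning

fold-≡ : ∀ {m} {x y : Fin (m + m)} → fold x ≡ fold y → x ≡ y ⊎ x ≡ opposite y
fold-≡ {m} {x} {y} eq with splitView m x | splitView m y
... | left a  | left b  = inj₁ (cong (_↑ˡ m) (trans (sym (fold-↑ˡ a)) (trans eq (fold-↑ˡ b))))
... | right a | right b =
  inj₁ (cong (m ↑ʳ_) (opposite-injective (trans (sym (fold-↑ʳ a)) (trans eq (fold-↑ʳ b)))))
... | left a  | right b = inj₂ (trans (cong (_↑ˡ m) a≡b′) (sym (opposite-↑ʳ b)))
  where a≡b′ = trans (sym (fold-↑ˡ a)) (trans eq (fold-↑ʳ b))
... | right a | left b  = inj₂ (trans (cong (m ↑ʳ_) a≡b′) (sym (opposite-↑ˡ b)))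
  where
  a≡b′ = trans (sym (opposite-involutive a)) (cong opposite (trans (sym (fold-↑ʳ a)) (trans eq (fold-↑ˡ b))))

≢opposite : ∀ {m} (x : Fin (m + m)) → x ≢ opposite x
≢opposite {m} x with splitView m x
... | left a  = λ eq → ↑ˡ≢↑ʳ a (opposite a) (trans eq (opposite-↑ˡ a))
... | right b = λ eq → ↑ˡ≢↑ʳ (opposite b) b (sym (trans eq (opposite-↑ʳ b)))

δ-fold : ∀ {m} (x : Fin (m + m)) b → δ x (b ↑ˡ m) +q δ x (m ↑ʳ opposite b) ≡ δ (fold x) b
δ-fold {m} x b with splitView m x
... | left a  = begin
  δ (a ↑ˡ m) (b ↑ˡ m) +q δ (a ↑ˡ m) (m ↑ʳ opposite b)
    ≡⟨ cong₂ _+q_ (δ-injective (↑ˡ-injective m _ _) a b) (δ-≢ (↑ˡ≢↑ʳ a (opposite b))) ⟩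
  δ a b +q 0ℚ ≡⟨ ℚ.+-identityʳ _ ⟩
  δ a b       ≡⟨ cong (λ z → δ z b) (fold-↑ˡ a) ⟨
  δ (fold (a ↑ˡ m)) b ∎
  where open ≡-Reasoning
... | right c = begin
  δ (m ↑ʳ c) (b ↑ˡ m) +q δ (m ↑ʳ c) (m ↑ʳ opposite b)
    ≡⟨ cong₂ _+q_ (δ-≢ (↑ˡ≢↑ʳ b c ∘ sym)) (δ-injective (↑ʳ-injective m _ _) c (opposite b)) ⟩
  0ℚ +q δ c (opposite b)                ≡⟨ ℚ.+-identityˡ _ ⟩
  δ c (opposite b)                      ≡⟨ δ-injective opposite-injective c (opposite b) ⟨
  δ (opposite c) (opposite (opposite b)) ≡⟨ cong₂ δ (fold-↑ʳ c) (sym (opposite-involutive b)) ⟨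
  δ (fold (m ↑ʳ c)) b                   ∎
  where open ≡-Reasoning

reflectExtend : ∀ {m} → (Fin m → Fin (m + m)) → Fin (m + m) → Fin (m + m)
reflectExtend {m} h x = [ h , opposite ∘ h ∘ opposite ]′ (splitAt m x)

module _ {m} (h : Fin m → Fin (m + m)) where

  reflectExtend-↑ˡ : ∀ a → reflectExtend h (a ↑ˡ m) ≡ h a
  reflectExtend-↑ˡ a rewrite splitAt-↑ˡ m a m = refl

  reflectExtend-↑ʳ : ∀ b → reflectExtend h (m ↑ʳ b) ≡ opposite (h (opposite b))
  reflectExtend-↑ʳ b rewrite splitAt-↑ʳ m m b = refl

  reflectExtend-opposite : ∀ x → reflectExtend h (opposite x) ≡ opposite (reflectExtend h x)
  reflectExtend-opposite x with splitView m x
  ... | left a  = begin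
    reflectExtend h (opposite (a ↑ˡ m))  ≡⟨ cong (reflectExtend h) (opposite-↑ˡ a) ⟩
    reflectExtend h (m ↑ʳ opposite a)    ≡⟨ reflectExtend-↑ʳ (opposite a) ⟩
    opposite (h (opposite (opposite a))) ≡⟨ cong (opposite ∘ h) (opposite-involutive a) ⟩
    opposite (h a)                       ≡⟨ cong opposite (reflectExtend-↑ˡ a) ⟨
    opposite (reflectExtend h (a ↑ˡ m))  ∎
    where open ≡-Reasoning
  ... | right b = begin
    reflectExtend h (opposite (m ↑ʳ b))  ≡⟨ cong (reflectExtend h) (opposite-↑ʳ b) ⟩
    reflectExtend h (opposite b ↑ˡ m)    ≡⟨ reflectExtend-↑ˡ (opposite b) ⟩
    h (opposite b)                       ≡⟨ opposite-involutive _ ⟨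
    opposite (opposite (h (opposite b))) ≡⟨ cong opposite (reflectExtend-↑ʳ b) ⟨
    opposite (reflectExtend h (m ↑ʳ b))  ∎
    where open ≡-Reasoning

  -- Injectivity of fold ∘ h says that h is injective and never hits the reflection of its own image.
  module _ (fh-inj : Injective _≡_ _≡_ (fold {m} ∘ h)) where

    private
      h-injective : Injective _≡_ _≡_ h
      h-injective = fh-inj ∘ cong (fold {m})

      h≢opposite-h : ∀ a b → h a ≢ opposite (h b)
      h≢opposite-h a b eq with fh-inj {a} {b} (trans (cong (fold {m}) eq) (fold-opposite (h b)))
      ... | refl = ≢opposite {m} (h a) eq

    reflectExtend-injective : Injective _≡_ _≡_ (reflectExtend h)
    reflectExtend-injective {x} {y} eq with splitView m x | splitView m y
    ... | left a  | left b  = cong (_↑ˡ m) (h-injective (begin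
      h a                      ≡⟨ reflectExtend-↑ˡ a ⟨
      reflectExtend h (a ↑ˡ m) ≡⟨ eq ⟩
      reflectExtend h (b ↑ˡ m) ≡⟨ reflectExtend-↑ˡ b ⟩
      h b                      ∎))
      where open ≡-Reasoning
    ... | right a | right b = cong (m ↑ʳ_) (opposite-injective (h-injective (opposite-injective (begin
      opposite (h (opposite a)) ≡⟨ reflectExtend-↑ʳ a ⟨
      reflectExtend h (m ↑ʳ a)  ≡⟨ eq ⟩
      reflectExtend h (m ↑ʳ b)  ≡⟨ reflectExtend-↑ʳ b ⟩
      opposite (h (opposite b)) ∎))))
      where open ≡-Reasoning
    ... | left a  | right b = ⊥-elim (h≢opposite-h a (opposite b)
      (trans (sym (reflectExtend-↑ˡ a)) (trans eq (reflectExtend-↑ʳ b))))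
    ... | right a | left b  = ⊥-elim (h≢opposite-h b (opposite a)
      (sym (trans (sym (reflectExtend-↑ʳ a)) (trans eq (reflectExtend-↑ˡ b)))))

⟨$⟩ʳ-injective : ∀ {k} (σ : Permutation′ k) → Injective _≡_ _≡_ (σ ⟨$⟩ʳ_)
⟨$⟩ʳ-injective σ = Injection.injective (↔⇒↣ σ)

injective-cong : ∀ {k l} {f g : Fin k → Fin l} → (∀ x → f x ≡ g x) → Injective _≡_ _≡_ g → Injective _≡_ _≡_ f
injective-cong f≗g g-inj eq = g-inj (trans (sym (f≗g _)) (trans eq (f≗g _)))

insert-at : ∀ {m n} (i : Fin (suc m)) (j : Fin (suc n)) (π : Perm.Permutation m n) → insert i j π ⟨$⟩ʳ i ≡ j
insert-at i j π with i ≟ i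
... | yes _   = refl
... | no i≢i = ⊥-elim (i≢i refl)

injective⇒surjective : ∀ {n} (f : Fin n → Fin n) → Injective _≡_ _≡_ f → ∀ y → ∃ λ x → f x ≡ y
injective⇒surjective f f-inj y with any? (λ x → f x ≟ y)
... | yes hit = hit
-- A missed y would make x ↦ punchOut (y ≢ f x) an injection Fin (suc n) → Fin n.
injective⇒surjective {suc n} f f-inj y | no miss =
  ⊥-elim (ℕ.<-irrefl refl (injective⇒≤ {f = g} (f-inj ∘ punchOut-injective (y≢f _) (y≢f _))))
  where
  y≢f : ∀ x → y ≢ f x
  y≢f x eq = miss (x , sym eq)
  g : Fin (suc n) → Fin n
  g x = punchOut (y≢f x)

injective⇒isPermMatrix : ∀ {k} {M : Mat k} (f : Fin k → Fin k) → Injective _≡_ _≡_ f →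
                            (∀ i j → M i j ≡ δ (f i) j) → IsPermMatrix M
injective⇒isPermMatrix f f-inj M≗f = σ , M≗f
  where
  f⁻¹ = λ y → proj₁ (injective⇒surjective f f-inj y)
  σ = permutation f f⁻¹ (λ y → proj₂ (injective⇒surjective f f-inj y))
                       (λ x → f-inj (proj₂ (injective⇒surjective f f-inj (f x))))

-- Centrosymmetric block matrices

module _ {m} (A B C D : Mat m) where

  block-↑ˡ↑ˡ : ∀ a b → block A B C D (a ↑ˡ m) (b ↑ˡ m) ≡ A a b
  block-↑ˡ↑ˡ a b rewrite splitAt-↑ˡ m a m | splitAt-↑ˡ m b m = refl

  block-↑ˡ↑ʳ : ∀ a b → block A B C D (a ↑ˡ m) (m ↑ʳ b) ≡ B a b
  block-↑ˡ↑ʳ a b rewrite splitAt-↑ˡ m a m | splitAt-↑ʳ m m b = refl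

  block-↑ʳ↑ˡ : ∀ a b → block A B C D (m ↑ʳ a) (b ↑ˡ m) ≡ C a b
  block-↑ʳ↑ˡ a b rewrite splitAt-↑ʳ m m a | splitAt-↑ˡ m b m = refl

  block-↑ʳ↑ʳ : ∀ a b → block A B C D (m ↑ʳ a) (m ↑ʳ b) ≡ D a b
  block-↑ʳ↑ʳ a b rewrite splitAt-↑ʳ m m a | splitAt-↑ʳ m m b = refl

ᵖ-involutive : ∀ {k} (X : Mat k) i j → (X ᵖ ᵖ) i j ≡ X i j
ᵖ-involutive X i j = cong₂ X (opposite-involutive i) (opposite-involutive j)

block-centrosymmetric : ∀ {m} (A C : Mat m) → Centrosymmetric (block A C (C ᵖ) (A ᵖ))
block-centrosymmetric {m} A C x y with splitView m x | splitView m y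
... | left a  | left b  = begin
  M (opposite (a ↑ˡ m)) (opposite (b ↑ˡ m)) ≡⟨ cong₂ M (opposite-↑ˡ a) (opposite-↑ˡ b) ⟩
  M (m ↑ʳ opposite a) (m ↑ʳ opposite b)     ≡⟨ block-↑ʳ↑ʳ A C (C ᵖ) (A ᵖ) _ _ ⟩
  (A ᵖ ᵖ) a b                               ≡⟨ ᵖ-involutive A a b ⟩
  A a b                                     ≡⟨ block-↑ˡ↑ˡ A C (C ᵖ) (A ᵖ) a b ⟨
  M (a ↑ˡ m) (b ↑ˡ m)                       ∎
  where M = block A C (C ᵖ) (A ᵖ); open ≡-Reasoning
... | left a  | right b = begin
  M (opposite (a ↑ˡ m)) (opposite (m ↑ʳ b)) ≡⟨ cong₂ M (opposite-↑ˡ a) (opposite-↑ʳ b) ⟩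
  M (m ↑ʳ opposite a) (opposite b ↑ˡ m)     ≡⟨ block-↑ʳ↑ˡ A C (C ᵖ) (A ᵖ) _ _ ⟩
  (C ᵖ ᵖ) a b                               ≡⟨ ᵖ-involutive C a b ⟩
  C a b                                     ≡⟨ block-↑ˡ↑ʳ A C (C ᵖ) (A ᵖ) a b ⟨
  M (a ↑ˡ m) (m ↑ʳ b)                       ∎
  where M = block A C (C ᵖ) (A ᵖ); open ≡-Reasoning
... | right a | left b  = begin
  M (opposite (m ↑ʳ a)) (opposite (b ↑ˡ m)) ≡⟨ cong₂ M (opposite-↑ʳ a) (opposite-↑ˡ b) ⟩
  M (opposite a ↑ˡ m) (m ↑ʳ opposite b)     ≡⟨ block-↑ˡ↑ʳ A C (C ᵖ) (A ᵖ) _ _ ⟩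
  C (opposite a) (opposite b)               ≡⟨ block-↑ʳ↑ˡ A C (C ᵖ) (A ᵖ) a b ⟨
  M (m ↑ʳ a) (b ↑ˡ m)                       ∎
  where M = block A C (C ᵖ) (A ᵖ); open ≡-Reasoning
... | right a | right b = begin
  M (opposite (m ↑ʳ a)) (opposite (m ↑ʳ b)) ≡⟨ cong₂ M (opposite-↑ʳ a) (opposite-↑ʳ b) ⟩
  M (opposite a ↑ˡ m) (opposite b ↑ˡ m)     ≡⟨ block-↑ˡ↑ˡ A C (C ᵖ) (A ᵖ) _ _ ⟩
  A (opposite a) (opposite b)               ≡⟨ block-↑ʳ↑ʳ A C (C ᵖ) (A ᵖ) a b ⟨
  M (m ↑ʳ a) (m ↑ʳ b)                       ∎
  where M = block A C (C ᵖ) (A ᵖ); open ≡-Reasoning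

centrosymmetric-ext : ∀ {m} {X Y : Mat (m + m)} → Centrosymmetric X → Centrosymmetric Y →
                      (∀ a b → X (a ↑ˡ m) (b ↑ˡ m) ≡ Y (a ↑ˡ m) (b ↑ˡ m)) →
                      (∀ a b → X (a ↑ˡ m) (m ↑ʳ b) ≡ Y (a ↑ˡ m) (m ↑ʳ b)) → ∀ x y → X x y ≡ Y x y
centrosymmetric-ext {m} {X} {Y} X-centro Y-centro left≗ right≗ x y = byRow (splitView m x)
  where
  open ≡-Reasoning

  top : ∀ a y → X (a ↑ˡ m) y ≡ Y (a ↑ˡ m) y
  top a y with splitView m y
  ... | left b  = left≗ a b
  ... | right b = right≗ a b

  fromTop : ∀ {Z : Mat (m + m)} → Centrosymmetric Z → ∀ b → Z (m ↑ʳ b) y ≡ Z (opposite b ↑ˡ m) (opposite y)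
  fromTop {Z} Z-centro b = begin
    Z (m ↑ʳ b) y
      ≡⟨ cong₂ Z (trans (opposite-↑ˡ (opposite b)) (cong (m ↑ʳ_) (opposite-involutive b))) (opposite-involutive y) ⟨
    Z (opposite (opposite b ↑ˡ m)) (opposite (opposite y)) ≡⟨ Z-centro (opposite b ↑ˡ m) (opposite y) ⟩
    Z (opposite b ↑ˡ m) (opposite y)                       ∎

  byRow : ∀ {x} → SplitView m m x → X x y ≡ Y x y
  byRow (left a)  = top a y
  byRow (right b) = begin
    X (m ↑ʳ b) y                     ≡⟨ fromTop X-centro b ⟩
    X (opposite b ↑ˡ m) (opposite y) ≡⟨ top (opposite b) (opposite y) ⟩
    Y (opposite b ↑ˡ m) (opposite y) ≡⟨ fromTop Y-centro b ⟨
    Y (m ↑ʳ b) y                     ∎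

δ-centrosymmetric : ∀ {k} (f : Fin k → Fin k) → (∀ x → f (opposite x) ≡ opposite (f x)) →
                    Centrosymmetric (λ i j → δ (f i) j)
δ-centrosymmetric f f-opposite i j =
  trans (cong (λ z → δ z (opposite j)) (f-opposite i)) (δ-injective opposite-injective (f i) j)

isCentroPermMatrix-block : ∀ {m} (A C : Mat m) (h : Fin m → Fin (m + m)) → Injective _≡_ _≡_ (fold {m} ∘ h) →
                           (∀ a b → A a b ≡ δ (h a) (b ↑ˡ m)) → (∀ a b → C a b ≡ δ (h a) (m ↑ʳ b)) →
                           IsCentroPermMatrix (block A C (C ᵖ) (A ᵖ))
isCentroPermMatrix-block {m} A C h fh-inj A≗h C≗h =
  injective⇒isPermMatrix (reflectExtend h) (reflectExtend-injective h fh-inj) entries ,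
  block-centrosymmetric A C
  where
  entries = centrosymmetric-ext (block-centrosymmetric A C)
              (δ-centrosymmetric (reflectExtend h) (reflectExtend-opposite h))
              (λ a b → trans (block-↑ˡ↑ˡ A C (C ᵖ) (A ᵖ) a b)
                         (trans (A≗h a b) (cong (λ z → δ z (b ↑ˡ m)) (sym (reflectExtend-↑ˡ h a)))))
              (λ a b → trans (block-↑ˡ↑ʳ A C (C ᵖ) (A ᵖ) a b)
                         (trans (C≗h a b) (cong (λ z → δ z (m ↑ʳ b)) (sym (reflectExtend-↑ˡ h a)))))

isCentroPermMatrix-diagonalBlock : ∀ {m} {P : Mat m} → IsPermMatrix P → IsCentroPermMatrix (block P O O (P ᵖ))
isCentroPermMatrix-diagonalBlock {m} {P} (σ , P≗σ) =
  isCentroPermMatrix-block P O h (injective-cong (fold-↑ˡ ∘ (σ ⟨$⟩ʳ_)) (⟨$⟩ʳ-injective σ)) P≗h O≗h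
  where
  h : Fin m → Fin (m + m)
  h a = (σ ⟨$⟩ʳ a) ↑ˡ m
  P≗h : ∀ a b → P a b ≡ δ (h a) (b ↑ˡ m)
  P≗h a b = trans (P≗σ a b) (sym (δ-injective (↑ˡ-injective m _ _) (σ ⟨$⟩ʳ a) b))
  O≗h : ∀ a b → O a b ≡ δ (h a) (m ↑ʳ b)
  O≗h a b = sym (δ-≢ (↑ˡ≢↑ʳ (σ ⟨$⟩ʳ a) b))

module QCond-properties {m'} {i c : Fin (suc m')} {Q : Mat (suc m')} (qc : QCond i c Q) where

  Q-row-i : ∀ b → Q i b ≡ 0ℚ
  Q-row-i = proj₁ (proj₂ qc)

  private
    Q-column-c : ∀ a → Q a c ≡ 0ℚ
    Q-column-c = proj₁ (proj₂ (proj₂ qc))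
    τ = proj₁ (proj₂ (proj₂ (proj₂ qc)))
    minor≗τ = proj₂ (proj₂ (proj₂ (proj₂ qc)))

  ψ : Permutation′ (suc m')
  ψ = insert i c τ

  ψ-i : ψ ⟨$⟩ʳ i ≡ c
  ψ-i = insert-at i c τ

  Q-punchIn : ∀ k b → Q (punchIn i k) b ≡ δ (ψ ⟨$⟩ʳ punchIn i k) b
  Q-punchIn k b rewrite insert-punchIn i c τ k with c ≟ b
  ... | yes refl = trans (Q-column-c _) (sym (δ-≢ (punchInᵢ≢i c _)))
  ... | no c≢b   = begin
    Q (punchIn i k) b                      ≡⟨ cong (Q (punchIn i k)) (punchIn-punchOut c≢b) ⟨
    Q (punchIn i k) (punchIn c l)          ≡⟨ minor≗τ k l ⟩
    δ (τ ⟨$⟩ʳ k) l                         ≡⟨ δ-injective (punchIn-injective c _ _) _ l ⟨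
    δ (punchIn c (τ ⟨$⟩ʳ k)) (punchIn c l) ≡⟨ cong (δ (punchIn c (τ ⟨$⟩ʳ k))) (punchIn-punchOut c≢b) ⟩
    δ (punchIn c (τ ⟨$⟩ʳ k)) b             ∎
    where
    open ≡-Reasoning
    l = punchOut c≢b

  Q≗ψ : ∀ {a} → a ≢ i → ∀ b → Q a b ≡ δ (ψ ⟨$⟩ʳ a) b
  Q≗ψ a≢i b = subst (λ a → Q a b ≡ δ (ψ ⟨$⟩ʳ a) b) (punchIn-punchOut (a≢i ∘ sym)) (Q-punchIn _ b)

  Q+E-row-i : ∀ b → Q i b +q E i c i b ≡ δ (ψ ⟨$⟩ʳ i) b
  Q+E-row-i b = begin
    Q i b +q E i c i b ≡⟨ cong₂ _+q_ (Q-row-i b) (E-diag i c b) ⟩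
    0ℚ +q δ b c        ≡⟨ ℚ.+-identityˡ _ ⟩
    δ b c              ≡⟨ δ-sym b c ⟩
    δ c b              ≡⟨ cong (λ z → δ z b) ψ-i ⟨
    δ (ψ ⟨$⟩ʳ i) b     ∎
    where open ≡-Reasoning

  Q+E-isPermMatrix : IsPermMatrix (λ a b → Q a b +q E i c a b)
  Q+E-isPermMatrix = ψ , entries
    where
    entries : ∀ a b → Q a b +q E i c a b ≡ δ (ψ ⟨$⟩ʳ a) b
    entries a b = byRow (a ≟ i)
      where
      byRow : Dec (a ≡ i) → Q a b +q E i c a b ≡ δ (ψ ⟨$⟩ʳ a) b
      byRow (yes refl) = Q+E-row-i b
      byRow (no a≢i)   = trans (cong₂ _+q_ (Q≗ψ a≢i b) (E-≢ i c b a≢i)) (ℚ.+-identityʳ _)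

module _ {m'} {i j : Fin (suc m')} {Q : Mat (suc m')} (qc : QCond i (opposite j) Q) where
  open QCond-properties qc

  private
    m = suc m'

    -- Row i of the top half [Q  E i j] has its 1 in the right block, every other row in Q.
    h : Fin m → Fin (m + m)
    h a with a ≟ i
    ... | yes _ = m ↑ʳ j
    ... | no _  = (ψ ⟨$⟩ʳ a) ↑ˡ m

    fold-h : ∀ a → fold (h a) ≡ ψ ⟨$⟩ʳ a
    fold-h a with a ≟ i
    ... | yes refl = trans (fold-↑ʳ j) (sym ψ-i)
    ... | no _     = fold-↑ˡ _

    Q≗h : ∀ a b → Q a b ≡ δ (h a) (b ↑ˡ m)
    Q≗h a b with a ≟ i
    ... | yes refl = trans (Q-row-i b) (sym (δ-≢ (↑ˡ≢↑ʳ b j ∘ sym)))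
    ... | no a≢i   = trans (Q≗ψ a≢i b) (sym (δ-injective (↑ˡ-injective m _ _) (ψ ⟨$⟩ʳ a) b))

    E≗h : ∀ a b → E i j a b ≡ δ (h a) (m ↑ʳ b)
    E≗h a b with a ≟ i
    ... | yes refl = trans (δ-sym b j) (sym (δ-injective (↑ʳ-injective m _ _) j b))
    ... | no _     = sym (δ-≢ (↑ˡ≢↑ʳ (ψ ⟨$⟩ʳ a) b))

  isCentroPermMatrix-QBlock : IsCentroPermMatrix (block Q (E i j) (E i j ᵖ) (Q ᵖ))
  isCentroPermMatrix-QBlock =
    isCentroPermMatrix-block Q (E i j) h (injective-cong fold-h (⟨$⟩ʳ-injective ψ)) Q≗h E≗h

-- A + C J for P = [A C; Cᵖ Aᵖ], where J is the reversal matrix.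
foldTop : ∀ {m} → Mat (m + m) → Mat m
foldTop {m} P a b = P (a ↑ˡ m) (b ↑ˡ m) +q P (a ↑ˡ m) (m ↑ʳ opposite b)

centroPerm-opposite : ∀ {k} {P : Mat k} (σ : Permutation′ k) → (∀ i j → P i j ≡ permMat σ i j) →
                      Centrosymmetric P → ∀ x → σ ⟨$⟩ʳ opposite x ≡ opposite (σ ⟨$⟩ʳ x)
centroPerm-opposite {P = P} σ P≗σ P-centro x = δ≡1⇒≡ (begin
  δ (σ ⟨$⟩ʳ opposite x) (opposite (σ ⟨$⟩ʳ x)) ≡⟨ P≗σ _ _ ⟨
  P (opposite x) (opposite (σ ⟨$⟩ʳ x))        ≡⟨ P-centro x (σ ⟨$⟩ʳ x) ⟩
  P x (σ ⟨$⟩ʳ x)                              ≡⟨ P≗σ x _ ⟩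
  δ (σ ⟨$⟩ʳ x) (σ ⟨$⟩ʳ x)                     ≡⟨ δ-refl (σ ⟨$⟩ʳ x) ⟩
  1ℚ                                          ∎)
  where open ≡-Reasoning

foldTop-isPermMatrix : ∀ {m} {P : Mat (m + m)} → IsCentroPermMatrix P → IsPermMatrix (foldTop P)
foldTop-isPermMatrix {m} {P} ((σ , P≗σ) , P-centro) = injective⇒isPermMatrix φ φ-injective entries
  where
  φ : Fin m → Fin m
  φ a = fold (σ ⟨$⟩ʳ (a ↑ˡ m))

  entries : ∀ a b → foldTop P a b ≡ δ (φ a) b
  entries a b = trans (cong₂ _+q_ (P≗σ _ _) (P≗σ _ _)) (δ-fold (σ ⟨$⟩ʳ (a ↑ˡ m)) b)

  φ-injective : Injective _≡_ _≡_ φ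
  φ-injective {a} {a'} eq with fold-≡ eq
  ... | inj₁ same     = ↑ˡ-injective m a a' (⟨$⟩ʳ-injective σ same)
  ... | inj₂ opposed  = ⊥-elim (↑ˡ≢↑ʳ a (opposite a') (⟨$⟩ʳ-injective σ (begin
    σ ⟨$⟩ʳ (a ↑ˡ m)              ≡⟨ opposed ⟩
    opposite (σ ⟨$⟩ʳ (a' ↑ˡ m))  ≡⟨ centroPerm-opposite σ P≗σ P-centro (a' ↑ˡ m) ⟨
    σ ⟨$⟩ʳ opposite (a' ↑ˡ m)    ≡⟨ cong (σ ⟨$⟩ʳ_) (opposite-↑ˡ a') ⟩
    σ ⟨$⟩ʳ (m ↑ʳ opposite a')    ∎)))
    where open ≡-Reasoning

-- Linear combinations

lincomb₂ : ∀ {k m n} → (Fin m → Fin n → ℚ) → (Fin m → Fin n → Mat k) → Mat k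
lincomb₂ C F a b = Σ[ (λ i → Σ[ (λ j → C i j *q F i j a b) ]) ]

flatten : ∀ {m n} {A : Set} → (Fin m → Fin n → A) → Fin (m * n) → A
flatten {m} {n} F u = F (proj₁ (remQuot {m} n u)) (proj₂ (remQuot {m} n u))

lincomb-flatten : ∀ {k m n} (C : Fin m → Fin n → ℚ) (F : Fin m → Fin n → Mat k) a b →
                  lincomb (flatten C) (flatten F) a b ≡ lincomb₂ C F a b
lincomb-flatten {m = m} C F a b = trans (Σ-combine m (λ u → flatten C u *q flatten F u a b))
  (Σ-cong λ i → Σ-cong λ j →
    cong (λ (p : Fin m × Fin _) → C (proj₁ p) (proj₂ p) *q F (proj₁ p) (proj₂ p) a b) (remQuot-combine {m} i j))

lincomb-split : ∀ {k} r {l} (c : Fin (r + l) → ℚ) (F : Fin (r + l) → Mat k) a b →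
                lincomb c F a b ≡ lincomb (c ∘ (_↑ˡ l)) (F ∘ (_↑ˡ l)) a b +q lincomb (c ∘ (r ↑ʳ_)) (F ∘ (r ↑ʳ_)) a b
lincomb-split r c F a b = Σ-split r (λ t → c t *q F t a b)

lincomb₂-+ : ∀ {k m n} (C : Fin m → Fin n → ℚ) (F F′ : Fin m → Fin n → Mat k) a b →
             lincomb₂ C (λ i j a b → F i j a b +q F′ i j a b) a b ≡ lincomb₂ C F a b +q lincomb₂ C F′ a b
lincomb₂-+ C F F′ a b = begin
  Σ[ (λ i → Σ[ (λ j → C i j *q (F i j a b +q F′ i j a b)) ]) ]
    ≡⟨ Σ-cong (λ i → Σ-cong λ j → ℚ.*-distribˡ-+ (C i j) _ _) ⟩
  Σ[ (λ i → Σ[ (λ j → C i j *q F i j a b +q C i j *q F′ i j a b) ]) ]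
    ≡⟨ Σ-cong (λ i → Σ-+ (λ j → C i j *q F i j a b) (λ j → C i j *q F′ i j a b)) ⟩
  Σ[ (λ i → Σ[ (λ j → C i j *q F i j a b) ] +q Σ[ (λ j → C i j *q F′ i j a b) ]) ]
    ≡⟨ Σ-+ (λ i → Σ[ (λ j → C i j *q F i j a b) ]) (λ i → Σ[ (λ j → C i j *q F′ i j a b) ]) ⟩
  lincomb₂ C F a b +q lincomb₂ C F′ a b ∎
  where open ≡-Reasoning

lincomb₂-neg : ∀ {k m n} (C : Fin m → Fin n → ℚ) (F : Fin m → Fin n → Mat k) a b →
               lincomb₂ (λ i j → -q C i j) F a b ≡ -q lincomb₂ C F a b
lincomb₂-neg C F a b = begin
  Σ[ (λ i → Σ[ (λ j → -q C i j *q F i j a b) ]) ]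
    ≡⟨ Σ-cong (λ i → Σ-cong λ j → sym (ℚ.neg-distribˡ-* (C i j) _)) ⟩
  Σ[ (λ i → Σ[ (λ j → -q (C i j *q F i j a b)) ]) ]
    ≡⟨ Σ-cong (λ i → Σ-neg (λ j → C i j *q F i j a b)) ⟩
  Σ[ (λ i → -q Σ[ (λ j → C i j *q F i j a b) ]) ]
    ≡⟨ Σ-neg (λ i → Σ[ (λ j → C i j *q F i j a b) ]) ⟩
  -q lincomb₂ C F a b ∎
  where open ≡-Reasoning

lincomb₂-E : ∀ {m} (C : Fin m → Fin m → ℚ) (π : Permutation′ m) a b →
             lincomb₂ C (λ i j → E i (π ⟨$⟩ʳ j)) a b ≡ C a (π ⟨$⟩ˡ b)
lincomb₂-E {m} C π a b = begin
  Σ[ (λ i → Σ[ term i ]) ]       ≡⟨ Σ-single (λ i → Σ[ term i ]) a other-rows ⟩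
  Σ[ term a ]                    ≡⟨ Σ-single (term a) (π ⟨$⟩ˡ b) other-columns ⟩
  term a (π ⟨$⟩ˡ b)              ≡⟨ cong (C a (π ⟨$⟩ˡ b) *q_) (trans (E-diag a _ b) (trans (cong (δ b) (inverseʳ π)) (δ-refl b))) ⟩
  C a (π ⟨$⟩ˡ b) *q 1ℚ           ≡⟨ ℚ.*-identityʳ _ ⟩
  C a (π ⟨$⟩ˡ b)                 ∎
  where
  open ≡-Reasoning
  term : Fin m → Fin m → ℚ
  term i j = C i j *q E i (π ⟨$⟩ʳ j) a b
  other-rows : ∀ i → i ≢ a → Σ[ term i ] ≡ 0ℚ
  other-rows i i≢a = Σ-zero λ j → trans (cong (C i j *q_) (E-≢ i _ b (i≢a ∘ sym))) (ℚ.*-zeroʳ (C i j))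
  other-columns : ∀ j → j ≢ π ⟨$⟩ˡ b → term a j ≡ 0ℚ
  other-columns j j≢π⁻¹b = trans (cong (C a j *q_) (trans (E-diag a _ b) (δ-≢ b≢πj))) (ℚ.*-zeroʳ (C a j))
    where
    b≢πj : b ≢ π ⟨$⟩ʳ j
    b≢πj b≡πj = j≢π⁻¹b (trans (sym (inverseˡ π)) (cong (π ⟨$⟩ˡ_) (sym b≡πj)))

lincomb-centrosymmetric : ∀ {k r} (c : Fin r → ℚ) {F : Fin r → Mat k} → (∀ t → Centrosymmetric (F t)) →
                          Centrosymmetric (lincomb c F)
lincomb-centrosymmetric c F-centro i j = Σ-cong (λ t → cong (c t *q_) (F-centro t i j))

Span-member : ∀ {k} {S : Mat k → Set} {M : Mat k} → S M → Span S M
Span-member {M = M} SM = 1 , (λ _ → M) , (λ _ → SM) , (λ _ → 1ℚ) ,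
  λ i j → sym (trans (ℚ.+-identityʳ _) (ℚ.*-identityˡ _))

Span⊆InSpanFam : ∀ {k r} {S : Mat k → Set} {G : Fin r → Mat k} →
                 (∀ M → S M → InSpanFam G M) → ∀ M → Span S M → InSpanFam G M
Span⊆InSpanFam {G = G} S⊆G M (_ , F , F∈S , c , M≗cF) = d , M≗dG
  where
  F≗G = λ t → S⊆G (F t) (F∈S t)
  d = λ u → Σ[ (λ t → c t *q proj₁ (F≗G t) u) ]
  M≗dG : ∀ x y → M x y ≡ lincomb d G x y
  M≗dG x y = begin
    M x y ≡⟨ M≗cF x y ⟩
    Σ[ (λ t → c t *q F t x y) ]
      ≡⟨ Σ-cong (λ t → cong (c t *q_) (proj₂ (F≗G t) x y)) ⟩
    Σ[ (λ t → c t *q Σ[ (λ u → proj₁ (F≗G t) u *q G u x y) ]) ]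
      ≡⟨ Σ-cong (λ t → sym (Σ-*ˡ (c t) (λ u → proj₁ (F≗G t) u *q G u x y))) ⟩
    Σ[ (λ t → Σ[ (λ u → c t *q (proj₁ (F≗G t) u *q G u x y)) ]) ]
      ≡⟨ Σ-swap (λ t u → c t *q (proj₁ (F≗G t) u *q G u x y)) ⟩
    Σ[ (λ u → Σ[ (λ t → c t *q (proj₁ (F≗G t) u *q G u x y)) ]) ]
      ≡⟨ Σ-cong (λ u → trans (Σ-cong λ t → sym (ℚ.*-assoc (c t) _ _)) (Σ-*ʳ (λ t → c t *q proj₁ (F≗G t) u) (G u x y))) ⟩
    lincomb d G x y ∎
    where open ≡-Reasoning

module Family {m' r : ℕ} (B : Fin r → Mat (suc m')) (Q : Fin (suc m') → Fin (suc m') → Mat (suc m')) where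

  m : ℕ
  m = suc m'

  G : Fin (r + m * m) → Mat (m + m)
  G = theFamily B Q

  diagonalBlock : Fin r → Mat (m + m)
  diagonalBlock s = block (B s) O O (B s ᵖ)

  QBlock : Fin m → Fin m → Mat (m + m)
  QBlock i j = block (Q i j) (E i j) (E i j ᵖ) (Q i j ᵖ)

  theFamily-↑ˡ : ∀ s → G (s ↑ˡ (m * m)) ≡ diagonalBlock s
  theFamily-↑ˡ s rewrite splitAt-↑ˡ r s (m * m) = refl

  theFamily-↑ʳ : ∀ u → G (r ↑ʳ u) ≡ flatten QBlock u
  theFamily-↑ʳ u rewrite splitAt-↑ʳ r (m * m) u = refl

  coeffᴮ : (Fin (r + m * m) → ℚ) → Fin r → ℚ
  coeffᴮ c s = c (s ↑ˡ (m * m))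

  coeffᴱ : (Fin (r + m * m) → ℚ) → Fin m → Fin m → ℚ
  coeffᴱ c i j = c (r ↑ʳ combine i j)

  lincomb-theFamily : ∀ c x y → lincomb c G x y ≡ lincomb (coeffᴮ c) diagonalBlock x y +q lincomb₂ (coeffᴱ c) QBlock x y
  lincomb-theFamily c x y = begin
    lincomb c G x y
      ≡⟨ lincomb-split r c G x y ⟩
    lincomb (coeffᴮ c) (G ∘ (_↑ˡ (m * m))) x y +q lincomb (c ∘ (r ↑ʳ_)) (G ∘ (r ↑ʳ_)) x y
      ≡⟨ cong₂ _+q_ (Σ-cong λ s → cong (λ M → coeffᴮ c s *q M x y) (theFamily-↑ˡ s))
                    (Σ-cong λ u → cong₂ (λ v M → c (r ↑ʳ v) *q M x y) (sym (combine-remQuot {m} m u)) (theFamily-↑ʳ u)) ⟩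
    lincomb (coeffᴮ c) diagonalBlock x y +q lincomb (flatten (coeffᴱ c)) (flatten QBlock) x y
      ≡⟨ cong (lincomb (coeffᴮ c) diagonalBlock x y +q_) (lincomb-flatten (coeffᴱ c) QBlock x y) ⟩
    lincomb (coeffᴮ c) diagonalBlock x y +q lincomb₂ (coeffᴱ c) QBlock x y ∎
    where open ≡-Reasoning

  lincomb-theFamily-↑ˡ↑ˡ : ∀ c a b → lincomb c G (a ↑ˡ m) (b ↑ˡ m) ≡ lincomb (coeffᴮ c) B a b +q lincomb₂ (coeffᴱ c) Q a b
  lincomb-theFamily-↑ˡ↑ˡ c a b = trans (lincomb-theFamily c _ _) (cong₂ _+q_
    (Σ-cong λ s → cong (coeffᴮ c s *q_) (block-↑ˡ↑ˡ (B s) O O (B s ᵖ) a b))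
    (Σ-cong λ i → Σ-cong λ j → cong (coeffᴱ c i j *q_) (block-↑ˡ↑ˡ (Q i j) (E i j) (E i j ᵖ) (Q i j ᵖ) a b)))

  lincomb-theFamily-↑ˡ↑ʳ : ∀ c a b → lincomb c G (a ↑ˡ m) (m ↑ʳ b) ≡ coeffᴱ c a b
  lincomb-theFamily-↑ˡ↑ʳ c a b = begin
    lincomb c G (a ↑ˡ m) (m ↑ʳ b)
      ≡⟨ lincomb-theFamily c _ _ ⟩
    lincomb (coeffᴮ c) diagonalBlock (a ↑ˡ m) (m ↑ʳ b) +q lincomb₂ (coeffᴱ c) QBlock (a ↑ˡ m) (m ↑ʳ b)
      ≡⟨ cong₂ _+q_
           (Σ-zero λ s → trans (cong (coeffᴮ c s *q_) (block-↑ˡ↑ʳ (B s) O O (B s ᵖ) a b)) (ℚ.*-zeroʳ (coeffᴮ c s)))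
           (Σ-cong λ i → Σ-cong λ j → cong (coeffᴱ c i j *q_) (block-↑ˡ↑ʳ (Q i j) (E i j) (E i j ᵖ) (Q i j ᵖ) a b)) ⟩
    0ℚ +q lincomb₂ (coeffᴱ c) E a b ≡⟨ ℚ.+-identityˡ _ ⟩
    lincomb₂ (coeffᴱ c) E a b       ≡⟨ lincomb₂-E (coeffᴱ c) Perm.id a b ⟩
    coeffᴱ c a b                    ∎
    where open ≡-Reasoning

  theFamily-linIndep : LinIndep B → LinIndep G
  theFamily-linIndep B-indep c c·G≡0 t with splitView r t
  ... | left s  = B-indep (coeffᴮ c) c·B≡0 s
    where
    coeffᴱ≡0 : ∀ i j → coeffᴱ c i j ≡ 0ℚ
    coeffᴱ≡0 i j = trans (sym (lincomb-theFamily-↑ˡ↑ʳ c i j)) (c·G≡0 _ _)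
    c·B≡0 : ∀ a b → lincomb (coeffᴮ c) B a b ≡ 0ℚ
    c·B≡0 a b = begin
      lincomb (coeffᴮ c) B a b                                ≡⟨ ℚ.+-identityʳ _ ⟨
      lincomb (coeffᴮ c) B a b +q 0ℚ
        ≡⟨ cong (lincomb (coeffᴮ c) B a b +q_) (sym (Σ-zero λ i → Σ-zero λ j →
             trans (cong (_*q Q i j a b) (coeffᴱ≡0 i j)) (ℚ.*-zeroˡ (Q i j a b)))) ⟩
      lincomb (coeffᴮ c) B a b +q lincomb₂ (coeffᴱ c) Q a b ≡⟨ lincomb-theFamily-↑ˡ↑ˡ c a b ⟨
      lincomb c G (a ↑ˡ m) (b ↑ˡ m)                          ≡⟨ c·G≡0 _ _ ⟩
      0ℚ                                                     ∎
      where open ≡-Reasoning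
  ... | right u = begin
    c (r ↑ʳ u)                          ≡⟨ cong (λ v → c (r ↑ʳ v)) (combine-remQuot {m} m u) ⟨
    flatten (coeffᴱ c) u                ≡⟨ lincomb-theFamily-↑ˡ↑ʳ c i j ⟨
    lincomb c G (i ↑ˡ m) (m ↑ʳ j)       ≡⟨ c·G≡0 _ _ ⟩
    0ℚ                                  ∎
    where
    open ≡-Reasoning
    i = proj₁ (remQuot {m} m u)
    j = proj₂ (remQuot {m} m u)

  theFamily-centrosymmetric : ∀ t → Centrosymmetric (G t)
  theFamily-centrosymmetric t with splitView r t
  ... | left s  = subst Centrosymmetric (sym (theFamily-↑ˡ s)) (block-centrosymmetric (B s) O)
  ... | right u = subst Centrosymmetric (sym (theFamily-↑ʳ u)) (block-centrosymmetric (Q i j) (E i j))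
    where
    i = proj₁ (remQuot {m} m u)
    j = proj₂ (remQuot {m} m u)

  theFamily-isCentroPermMatrix : (∀ s → IsPermMatrix (B s)) → (∀ i j → QCond i (opposite j) (Q i j)) →
                                 ∀ t → IsCentroPermMatrix (G t)
  theFamily-isCentroPermMatrix B-perm qc t with splitView r t
  ... | left s  = subst IsCentroPermMatrix (sym (theFamily-↑ˡ s)) (isCentroPermMatrix-diagonalBlock (B-perm s))
  ... | right u = subst IsCentroPermMatrix (sym (theFamily-↑ʳ u)) (isCentroPermMatrix-QBlock (qc i j))
    where
    i = proj₁ (remQuot {m} m u)
    j = proj₂ (remQuot {m} m u)

  joinCoeffs : (Fin r → ℚ) → (Fin m → Fin m → ℚ) → Fin (r + m * m) → ℚ
  joinCoeffs e C t = [ e , flatten C ]′ (splitAt r t)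

  coeffᴮ-joinCoeffs : ∀ e C s → coeffᴮ (joinCoeffs e C) s ≡ e s
  coeffᴮ-joinCoeffs e C s rewrite splitAt-↑ˡ r s (m * m) = refl

  coeffᴱ-joinCoeffs : ∀ e C i j → coeffᴱ (joinCoeffs e C) i j ≡ C i j
  coeffᴱ-joinCoeffs e C i j rewrite splitAt-↑ʳ r (m * m) (combine i j) =
    cong (λ (p : Fin m × Fin m) → C (proj₁ p) (proj₂ p)) (remQuot-combine i j)

  module _ (qc : ∀ i j → QCond i (opposite j) (Q i j)) (B-spans : ∀ M → 𝓛 m M → InSpanFam B M)
           {P : Mat (m + m)} (P-centroPerm : IsCentroPermMatrix P) where

    private
      A C : Mat m
      A a b = P (a ↑ˡ m) (b ↑ˡ m)
      C a b = P (a ↑ˡ m) (m ↑ʳ b)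

      X : Mat m
      X a b = A a b +q -q lincomb₂ C Q a b

      QE : Fin m → Fin m → Mat m
      QE i j a b = Q i j a b +q E i (opposite j) a b

      -- foldTop P = A + Σ C i j E i (opposite j), so X = foldTop P - Σ C i j (Q i j + E i (opposite j)).
      X∈𝓛 : 𝓛 m X
      X∈𝓛 = suc (m * m) , FX , FX-perm , cX , X≗
        where
        FX : Fin (suc (m * m)) → Mat m
        FX zero    = foldTop P
        FX (suc u) = flatten QE u
        FX-perm : ∀ t → IsPermMatrix (FX t)
        FX-perm zero    = foldTop-isPermMatrix P-centroPerm
        FX-perm (suc u) = QCond-properties.Q+E-isPermMatrix (qc _ _)
        cX : Fin (suc (m * m)) → ℚ
        cX zero    = 1ℚ
        cX (suc u) = flatten (λ i j → -q C i j) u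
        X≗ : ∀ a b → X a b ≡ lincomb cX FX a b
        X≗ a b = sym (begin
          1ℚ *q foldTop P a b +q lincomb (flatten (λ i j → -q C i j)) (flatten QE) a b
            ≡⟨ cong (1ℚ *q foldTop P a b +q_) (lincomb-flatten (λ i j → -q C i j) QE a b) ⟩
          1ℚ *q foldTop P a b +q lincomb₂ (λ i j → -q C i j) QE a b
            ≡⟨ cong (1ℚ *q foldTop P a b +q_) (lincomb₂-neg C QE a b) ⟩
          1ℚ *q foldTop P a b +q -q lincomb₂ C QE a b
            ≡⟨ cong (λ z → 1ℚ *q foldTop P a b +q -q z) (lincomb₂-+ C Q (λ i j → E i (opposite j)) a b) ⟩
          1ℚ *q (A a b +q C a (opposite b)) +q -q (lincomb₂ C Q a b +q lincomb₂ C (λ i j → E i (opposite j)) a b)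
            ≡⟨ cong (λ z → 1ℚ *q (A a b +q C a (opposite b)) +q -q (lincomb₂ C Q a b +q z)) (lincomb₂-E C Perm.reverse a b) ⟩
          1ℚ *q (A a b +q C a (opposite b)) +q -q (lincomb₂ C Q a b +q C a (opposite b))
            ≡⟨ solve 3 (λ x y z → con 1ℚ :* (x :+ y) :+ :- (z :+ y) := x :+ :- z) refl (A a b) (C a (opposite b)) (lincomb₂ C Q a b) ⟩
          X a b ∎)
          where open ≡-Reasoning

      e : Fin r → ℚ
      e = proj₁ (B-spans X X∈𝓛)

      c : Fin (r + m * m) → ℚ
      c = joinCoeffs e C

      top-left : ∀ a b → A a b ≡ lincomb c G (a ↑ˡ m) (b ↑ˡ m)
      top-left a b = begin
        A a b                                           ≡⟨ solve 2 (λ x z → x := (x :+ :- z) :+ z) refl (A a b) (lincomb₂ C Q a b) ⟩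
        X a b +q lincomb₂ C Q a b                       ≡⟨ cong (_+q lincomb₂ C Q a b) (proj₂ (B-spans X X∈𝓛) a b) ⟩
        lincomb e B a b +q lincomb₂ C Q a b
          ≡⟨ cong₂ _+q_ (Σ-cong λ s → cong (_*q B s a b) (sym (coeffᴮ-joinCoeffs e C s)))
                        (Σ-cong λ i → Σ-cong λ j → cong (_*q Q i j a b) (sym (coeffᴱ-joinCoeffs e C i j))) ⟩
        lincomb (coeffᴮ c) B a b +q lincomb₂ (coeffᴱ c) Q a b ≡⟨ lincomb-theFamily-↑ˡ↑ˡ c a b ⟨
        lincomb c G (a ↑ˡ m) (b ↑ˡ m)                    ∎
        where open ≡-Reasoning

      top-right : ∀ a b → C a b ≡ lincomb c G (a ↑ˡ m) (m ↑ʳ b)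
      top-right a b = trans (sym (coeffᴱ-joinCoeffs e C a b)) (sym (lincomb-theFamily-↑ˡ↑ʳ c a b))

    centroPerm-inSpan : InSpanFam G P
    centroPerm-inSpan = c , centrosymmetric-ext (proj₂ P-centroPerm) (lincomb-centrosymmetric c theFamily-centrosymmetric)
                              top-left top-right

theorem2p9 : (m' : ℕ) → (r : ℕ) → (B : Fin r → Defs.Mat (suc m'))
    → (∀ t → IsPermMatrix (B t)) → IsBasisOf (𝓛 (suc m')) B
    → (Q : Fin (suc m') → Fin (suc m') → Mat (suc m'))
    → (∀ i j → QCond i (opposite j) (Q i j))
    → (∀ t → IsCentroPermMatrix (theFamily B Q t))
      × IsBasisOf (𝓒 (suc m' + suc m')) (theFamily B Q)
theorem2p9 m' r B B-perm (_ , B-indep , B-spans) Q qc =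
  G-centroPerm , (G∈𝓒 , theFamily-linIndep B-indep , Span⊆InSpanFam (λ P → centroPerm-inSpan qc B-spans))
  where
  open Family B Q
  G-centroPerm : ∀ t → IsCentroPermMatrix (G t)
  G-centroPerm = theFamily-isCentroPermMatrix B-perm qc
  G∈𝓒 : ∀ t → 𝓒 (m + m) (G t)
  G∈𝓒 t = Span-member {S = IsCentroPermMatrix} (G-centroPerm t)
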